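{- Let $G$ be an (undirected) graph of degeneracy $k$. Then $f(G)\leq \frac{k-1}{k+1}n(G)$ if $k$ is odd, and $f(G)\leq \frac{k}{k+2}n(G)$ if $k$ is even.
   Context: Graphs are finite and simple. A feedback vertex set is a set of vertices whose deletion leaves a forest; $f(G)$ is the minimum size of a feedback vertex set and $n(G)$ the number of vertices. The degeneracy of $G$ is the least $k$ such that there is an ordering of $V(G)$ in which every vertex has at most $k$ neighbours preceding it. -}

module Defs where

open import Data.Nat using (ℕ; zero; suc; _+_; _*_; _≤_; _<_)
open import Data.Nat.Properties using ()
open import Data.Bool using (Bool; true; false; _∧_)
open import Data.Fin using (Fin; zero; suc; inject₁; fromℕ; toℕ)
open import Data.Fin.Subset using (Subset; _∈_; _∉_; ∣_∣)
open import Data.Fin.Permutation using (Permutation′; _⟨$⟩ʳ_)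
open import Data.Vec using (tabulate)
open import Data.Product using (Σ; ∃; _×_)
open import Relation.Binary.PropositionalEquality using (_≡_)
open import Relation.Nullary using (¬_)
open import Relation.Nullary.Decidable using (⌊_⌋)
open import Function.Definitions using (Injective)
open import Data.Nat using (_<?_)

record Graph (n : ℕ) : Set where
  field
    adj   : Fin n → Fin n → Bool
    sym   : ∀ u v → adj u v ≡ adj v u
    irrefl : ∀ v → adj v v ≡ false
open Graph public

nV : ∀ {n} → Graph n → ℕ
nV {n} _ = n

backDeg : ∀ {n} → Graph n → Permutation′ n → Fin n → ℕ
backDeg G σ v =
  ∣ tabulate (λ u → adj G u v ∧ ⌊ toℕ (σ ⟨$⟩ʳ u) <? toℕ (σ ⟨$⟩ʳ v) ⌋) ∣

HasDegOrdering : ∀ {n} → Graph n → ℕ → Set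
HasDegOrdering G k = Σ (Permutation′ _) λ σ → ∀ v → backDeg G σ v ≤ k

Degeneracy : ∀ {n} → Graph n → ℕ → Set
Degeneracy G k = HasDegOrdering G k × (∀ j → HasDegOrdering G j → k ≤ j)

-- A cycle of length m+3 in G avoiding the vertex set S:
-- distinct vertices c 0, …, c (m+2), consecutive ones adjacent, last adjacent to first.
record CycleAvoiding {n} (G : Graph n) (S : Subset n) (m : ℕ) : Set where
  field
    c        : Fin (suc (suc (suc m))) → Fin n
    distinct : Injective _≡_ _≡_ c
    step     : ∀ (i : Fin (suc (suc m))) → adj G (c (inject₁ i)) (c (suc i)) ≡ true
    close    : adj G (c (fromℕ (suc (suc m)))) (c zero) ≡ true
    avoid    : ∀ i → c i ∉ S

-- G - S is a forest (acyclic) iff it has no cycle.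
IsFeedbackVertexSet : ∀ {n} → Graph n → Subset n → Set
IsFeedbackVertexSet G S = ∀ m → ¬ CycleAvoiding G S m

-- f(G) ≤ (p / q) · n(G)   (for q > 0).  f(G) is the minimum size of a feedback
-- vertex set (V(G) is always one), so this holds iff some feedback vertex set S
-- satisfies |S| ≤ (p/q)·n, i.e. q·|S| ≤ p·n.
FVSNumberAtMostFrac : ∀ {n} → Graph n → ℕ → ℕ → Set
FVSNumberAtMostFrac {n} G p q =
  Σ (Subset n) λ S → IsFeedbackVertexSet G S × q * ∣ S ∣ ≤ p * n

{-# OPTIONS --safe #-}
-- Fix an ordering in which every vertex has at most k earlier neighbours, with
-- k < 2(t+1).  Colour the vertices greedily along the ordering with t+1
-- colours so that each vertex has at most one earlier neighbour of its own
-- colour: among at most k < 2(t+1) earlier neighbours some colour occurs at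
-- most once.  Every colour class then induces a forest, since the last vertex
-- of a monochromatic cycle would have two earlier neighbours of its colour.
-- The largest class has at least n/(t+1) vertices, so its complement is a
-- feedback vertex set of size at most t/(t+1)·n; and t/(t+1) is (k-1)/(k+1)
-- for k = 2t+1 and k/(k+2) for k = 2t.
module Submission where

open import Defs hiding (sym)
open import Data.Nat using (ℕ; suc; _+_; _∸_; _%_)
open import Data.Product using (_×_)
open import Relation.Binary.PropositionalEquality using (_≡_)

open import Data.Nat using (zero; _*_; _≤_; _<_; _≤?_; _<?_; z≤n; s≤s; s≤s⁻¹)
open import Data.Nat.Properties
  using ( ≤-refl; ≤-reflexive; ≤-trans; <-trans; ≤-<-trans; <⇒≤; <⇒≢; <⇒≱; ≤⇒≯; ≰⇒>
        ; ≤∧≢⇒<; n≤1+n; m<1+n⇒m<n∨m≡n; m∸n+n≡m; +-comm; +-mono-≤; +-monoˡ-≤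
        ; +-cancelʳ-≤; *-distribˡ-+; *-monoˡ-≤; +-0-commutativeMonoid
        ; *-commutativeSemigroup; module ≤-Reasoning)
open import Data.Nat.DivMod using (_/_; m≡m%n+[m/n]*n)
open import Algebra.Properties.CommutativeSemigroup *-commutativeSemigroup using (xy∙z≈xz∙y)
open import Algebra.Properties.CommutativeMonoid.Sum +-0-commutativeMonoid
  using (sum; sum-syntax; sum-cong-≗; sum-replicate-zero; ∑-distrib-+)
open import Data.Bool using (Bool; true; false; _∧_)
open import Data.Bool.Properties using (∧-zeroʳ)
open import Data.Fin using (Fin; zero; suc; toℕ; fromℕ; fromℕ<; inject₁; _≟_)
open import Data.Fin.Properties using (toℕ-injective; toℕ<n; toℕ-fromℕ<; suc-injective; ¬∀⟶∃¬)
open import Data.Fin.Relation.Unary.Top using (view; ‵fromℕ; ‵inject₁)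
open import Data.Fin.Subset using (Subset; _∈_; ∁; ∣_∣)
open import Data.Fin.Subset.Properties
  using (∣p∣≤n; ∣∁p∣≡n∸∣p∣; x∉∁p⇒x∈p; x∈p∧x≢y⇒x∈p-y; x∈p⇒∣p-x∣<∣p∣)
open import Data.Fin.Permutation using (Permutation′; _⟨$⟩ʳ_; _⟨$⟩ˡ_; inverseˡ; inverseʳ)
open import Data.Vec using (_∷_; tabulate)
open import Data.Vec.Properties using (tabulate-cong; lookup∘tabulate; lookup⇒[]=; []=⇒lookup)
open import Data.Vec.Functional using (updateAt)
open import Data.Vec.Functional.Properties using (updateAt-updates; updateAt-minimal)
open import Data.List using (allFin)
open import Data.List.Relation.Unary.All as All using ()
open import Data.List.Membership.Propositional.Properties using (∈-allFin)
open import Data.List.Extrema.Nat using (argmax; f[xs]≤f[argmax])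
open import Data.Product using (∃; ∃₂; _,_; proj₁; proj₂; map₂)
open import Data.Sum using (inj₁; inj₂)
open import Relation.Binary.PropositionalEquality
  using (_≢_; refl; sym; trans; cong; cong₂; subst; subst₂; module ≡-Reasoning)
open import Relation.Nullary.Decidable using (Dec; yes; no; ⌊_⌋; does; isYes≗does; dec-true)
open import Function using (_∘_; const)

private
  variable
    n m : ℕ

indicator : Bool → ℕ
indicator true  = 1
indicator false = 0

∣x∷p∣≡indicator+∣p∣ : ∀ x (p : Subset n) → ∣ x ∷ p ∣ ≡ indicator x + ∣ p ∣
∣x∷p∣≡indicator+∣p∣ true  p = refl
∣x∷p∣≡indicator+∣p∣ false p = refl

does≡true⇒ : ∀ {A : Set} (a? : Dec A) → does a? ≡ true → A
does≡true⇒ (yes a) _  = a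
does≡true⇒ (no _)  ()

∣tabulate-true∣ : ∣ tabulate {n = n} (const true) ∣ ≡ n
∣tabulate-true∣ {zero}  = refl
∣tabulate-true∣ {suc n} = cong suc (∣tabulate-true∣ {n})

∈-tabulate⁺ : ∀ {f : Fin n → Bool} {x} → f x ≡ true → x ∈ tabulate f
∈-tabulate⁺ {f = f} {x} fx = lookup⇒[]= x (tabulate f) (trans (lookup∘tabulate f x) fx)

∈-tabulate⁻ : ∀ {f : Fin n → Bool} {x} → x ∈ tabulate f → f x ≡ true
∈-tabulate⁻ {f = f} {x} x∈ = trans (sym (lookup∘tabulate f x)) ([]=⇒lookup x∈)

x∈p⇒1≤∣p∣ : ∀ {x} {p : Subset n} → x ∈ p → 1 ≤ ∣ p ∣
x∈p⇒1≤∣p∣ x∈p = ≤-trans (s≤s z≤n) (x∈p⇒∣p-x∣<∣p∣ x∈p)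

x∈p∧y∈p∧x≢y⇒2≤∣p∣ : ∀ {x y} {p : Subset n} → x ∈ p → y ∈ p → x ≢ y → 2 ≤ ∣ p ∣
x∈p∧y∈p∧x≢y⇒2≤∣p∣ x∈p y∈p x≢y =
  ≤-trans (s≤s (x∈p⇒1≤∣p∣ (x∈p∧x≢y⇒x∈p-y y∈p (x≢y ∘ sym)))) (x∈p⇒∣p-x∣<∣p∣ x∈p)

∑-≤-* : ∀ {g : Fin m → ℕ} {a} → (∀ i → g i ≤ a) → sum g ≤ m * a
∑-≤-* {zero}  _    = z≤n
∑-≤-* {suc m} g≤a = +-mono-≤ (g≤a zero) (∑-≤-* (g≤a ∘ suc))

*-≤-∑ : ∀ {g : Fin m → ℕ} {a} → (∀ i → a ≤ g i) → m * a ≤ sum g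
*-≤-∑ {zero}  _    = z≤n
*-≤-∑ {suc m} a≤g = +-mono-≤ (a≤g zero) (*-≤-∑ (a≤g ∘ suc))

∑<*⇒∃< : ∀ (g : Fin m → ℕ) {a} → sum g < m * a → ∃ λ i → g i < a
∑<*⇒∃< {m} g {a} ∑<* = map₂ ≰⇒> (¬∀⟶∃¬ m (λ i → a ≤ g i) (λ i → a ≤? g i) (<⇒≱ ∑<* ∘ *-≤-∑))

maxIndex : (Fin (suc m) → ℕ) → Fin (suc m)
maxIndex g = argmax g zero (allFin _)

≤-maxIndex : ∀ (g : Fin (suc m) → ℕ) i → g i ≤ g (maxIndex g)
≤-maxIndex g i = All.lookup (f[xs]≤f[argmax] {f = g} zero (allFin _)) (∈-allFin i)

∃-≥-average : ∀ (g : Fin (suc m) → ℕ) → ∃ λ i → sum g ≤ suc m * g i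
∃-≥-average g = maxIndex g , ∑-≤-* (≤-maxIndex g)

-- does rather than ⌊_⌋: does (suc x ≟ suc c) reduces to does (x ≟ c), ⌊ suc x ≟ suc c ⌋ does not.
ofColour : (Fin n → Bool) → (Fin n → Fin m) → Fin m → Subset n
ofColour f col c = tabulate (λ u → f u ∧ does (col u ≟ c))

colourClass : (Fin n → Fin m) → Fin m → Subset n
colourClass = ofColour (const true)

∑-indicator-≟ : ∀ (x : Fin m) → ∑[ c < m ] indicator (does (x ≟ c)) ≡ 1
∑-indicator-≟ {suc m} zero    = cong suc (sum-replicate-zero m)
∑-indicator-≟ {suc m} (suc x) = ∑-indicator-≟ {m} x

∑-indicator-∧-≟ : ∀ b (x : Fin m) → ∑[ c < m ] indicator (b ∧ does (x ≟ c)) ≡ indicator b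
∑-indicator-∧-≟ true      x = ∑-indicator-≟ x
∑-indicator-∧-≟ {m} false x = sum-replicate-zero m

∑-∣ofColour∣ : ∀ (f : Fin n → Bool) (col : Fin n → Fin m) →
               ∑[ c < m ] ∣ ofColour f col c ∣ ≡ ∣ tabulate f ∣
∑-∣ofColour∣ {zero}  {m} f col = sum-replicate-zero m
∑-∣ofColour∣ {suc n} {m} f col = begin
  ∑[ c < m ] ∣ ofColour f col c ∣
    ≡⟨ sum-cong-≗ (λ c → ∣x∷p∣≡indicator+∣p∣ (head c) (ofColour (f ∘ suc) (col ∘ suc) c)) ⟩
  ∑[ c < m ] (indicator (head c) + ∣ ofColour (f ∘ suc) (col ∘ suc) c ∣)
    ≡⟨ ∑-distrib-+ (indicator ∘ head) _ ⟩
  ∑[ c < m ] indicator (head c) + ∑[ c < m ] ∣ ofColour (f ∘ suc) (col ∘ suc) c ∣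
    ≡⟨ cong₂ _+_ (∑-indicator-∧-≟ (f zero) (col zero)) (∑-∣ofColour∣ (f ∘ suc) (col ∘ suc)) ⟩
  indicator (f zero) + ∣ tabulate (f ∘ suc) ∣
    ≡⟨ sym (∣x∷p∣≡indicator+∣p∣ (f zero) (tabulate (f ∘ suc))) ⟩
  ∣ tabulate f ∣ ∎
  where
  open ≡-Reasoning
  head : Fin m → Bool
  head c = f zero ∧ does (col zero ≟ c)

∃-sparse-colour : ∀ (f : Fin n → Bool) (col : Fin n → Fin m) →
                  ∣ tabulate f ∣ < m * 2 → ∃ λ c → ∣ ofColour f col c ∣ ≤ 1
∃-sparse-colour f col ∣f∣<2m =
  map₂ s≤s⁻¹ (∑<*⇒∃< (∣_∣ ∘ ofColour f col) (subst (_< _) (sym (∑-∣ofColour∣ f col)) ∣f∣<2m))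

∑-∣colourClass∣ : ∀ (col : Fin n → Fin m) → ∑[ c < m ] ∣ colourClass col c ∣ ≡ n
∑-∣colourClass∣ col = trans (∑-∣ofColour∣ (const true) col) ∣tabulate-true∣

inject₁²≢suc² : ∀ (i : Fin n) → inject₁ (inject₁ i) ≢ suc (suc i)
inject₁²≢suc² zero    ()
inject₁²≢suc² (suc i) eq = inject₁²≢suc² i (suc-injective eq)

module _ {G : Graph n} {S : Subset n} {m} (cycle : CycleAvoiding G S m) where
  open CycleAvoiding cycle

  cycle-neighbours : ∀ j → ∃₂ λ a b → a ≢ b × adj G (c a) (c j) ≡ true × adj G (c b) (c j) ≡ true
  cycle-neighbours zero = suc zero , fromℕ _ , (λ ()) , trans (Graph.sym G _ _) (step zero) , close
  cycle-neighbours (suc i) with view i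
  ... | ‵fromℕ      = inject₁ i , zero , (λ ()) , step i , trans (Graph.sym G _ _) close
  ... | ‵inject₁ i′ = inject₁ i , suc (suc i′) , inject₁²≢suc² i′ , step i
                    , trans (Graph.sym G _ _) (step (suc i′))

module _ (G : Graph n) (σ : Permutation′ n) where

  pos : Fin n → ℕ
  pos v = toℕ (σ ⟨$⟩ʳ v)

  pos-injective : ∀ {u v} → pos u ≡ pos v → u ≡ v
  pos-injective {u} {v} eq = begin
    u                  ≡⟨ inverseˡ σ ⟨
    σ ⟨$⟩ˡ (σ ⟨$⟩ʳ u)  ≡⟨ cong (σ ⟨$⟩ˡ_) (toℕ-injective eq) ⟩
    σ ⟨$⟩ˡ (σ ⟨$⟩ʳ v)  ≡⟨ inverseˡ σ ⟩
    v                  ∎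
    where open ≡-Reasoning

  earlier : Fin n → Fin n → Bool
  earlier v u = adj G u v ∧ ⌊ pos u <? pos v ⌋

  earlier-if-adjacent : ∀ {u v} → adj G u v ≡ true → pos u ≤ pos v → earlier v u ≡ true
  earlier-if-adjacent {u} {v} uv pu≤pv =
    cong₂ _∧_ uv (trans (isYes≗does (pos u <? pos v)) (dec-true (pos u <? pos v) (≤∧≢⇒< pu≤pv pu≢pv)))
    where
    pu≢pv : pos u ≢ pos v
    pu≢pv eq with pos-injective eq
    ... | refl with trans (sym uv) (irrefl G u)
    ...   | ()

  AtMostOneEarlierOfOwnColour : (Fin n → Fin m) → Fin n → Set
  AtMostOneEarlierOfOwnColour col v = ∣ ofColour (earlier v) col (col v) ∣ ≤ 1

  ∣ofColour-earlier∣-local : ∀ {col col′ : Fin n → Fin m} {v c} → col′ v ≡ c →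
    (∀ u → pos u < pos v → col′ u ≡ col u) →
    ∣ ofColour (earlier v) col′ (col′ v) ∣ ≡ ∣ ofColour (earlier v) col c ∣
  ∣ofColour-earlier∣-local {col = col} {col′} {v} {c} col′v≡c agree = cong ∣_∣ (tabulate-cong same)
    where
    same : ∀ u → (earlier v u ∧ does (col′ u ≟ col′ v)) ≡ (earlier v u ∧ does (col u ≟ c))
    same u with pos u <? pos v
    ... | yes u<v = cong₂ (λ d e → (adj G u v ∧ true) ∧ does (d ≟ e)) (agree u u<v) col′v≡c
    ... | no  _   rewrite ∧-zeroʳ (adj G u v) = refl

  greedy-colouring : (∀ v → backDeg G σ v < suc m * 2) → ∀ t → t ≤ n →
    ∃ λ (col : Fin n → Fin (suc m)) → ∀ v → pos v < t → AtMostOneEarlierOfOwnColour col v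
  greedy-colouring few zero _ = const zero , λ _ ()
  greedy-colouring {m} few (suc t) t<n with greedy-colouring few t (<⇒≤ t<n)
  ... | col , good = col′ , good′
    where
    w : Fin n
    w = σ ⟨$⟩ˡ fromℕ< t<n

    pos-w : pos w ≡ t
    pos-w = trans (cong toℕ (inverseʳ σ)) (toℕ-fromℕ< t<n)

    sparse : ∃ λ c → ∣ ofColour (earlier w) col c ∣ ≤ 1
    sparse = ∃-sparse-colour (earlier w) col (few w)

    col′ : Fin n → Fin (suc m)
    col′ = updateAt col w (const (proj₁ sparse))

    col′-below : ∀ u → pos u < t → col′ u ≡ col u
    col′-below u u<t = updateAt-minimal u w col (λ u≡w → <⇒≢ u<t (trans (cong pos u≡w) pos-w))

    good′ : ∀ v → pos v < suc t → AtMostOneEarlierOfOwnColour col′ v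
    good′ v v<1+t with m<1+n⇒m<n∨m≡n v<1+t
    ... | inj₁ v<t = subst (_≤ 1) (sym (∣ofColour-earlier∣-local (col′-below v v<t)
                       (λ u u<v → col′-below u (<-trans u<v v<t))))
                       (good v v<t)
    ... | inj₂ v≡t with pos-injective (trans v≡t (sym pos-w))
    ...   | refl = subst (_≤ 1) (sym (∣ofColour-earlier∣-local (updateAt-updates w col)
                     (λ u u<w → col′-below u (subst (pos u <_) pos-w u<w))))
                     (proj₂ sparse)

  ∃-colouring : (∀ v → backDeg G σ v < suc m * 2) →
    ∃ λ (col : Fin n → Fin (suc m)) → ∀ v → AtMostOneEarlierOfOwnColour col v
  ∃-colouring few = map₂ (λ good v → good v (toℕ<n _)) (greedy-colouring few n ≤-refl)

  ∁-colourClass-isFVS : ∀ (col : Fin n → Fin m) → (∀ v → AtMostOneEarlierOfOwnColour col v) →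
    ∀ c → IsFeedbackVertexSet G (∁ (colourClass col c))
  ∁-colourClass-isFVS col good c₀ _ cycle = ≤⇒≯ (good v) two-earlier
    where
    open CycleAvoiding cycle renaming (c to vertex)

    coloured : ∀ i → col (vertex i) ≡ c₀
    coloured i = does≡true⇒ (col (vertex i) ≟ c₀) (∈-tabulate⁻ (x∉∁p⇒x∈p (avoid i)))

    j : Fin _
    j = maxIndex (pos ∘ vertex)

    v : Fin n
    v = vertex j

    earlier-of-own-colour : ∀ i → adj G (vertex i) v ≡ true → vertex i ∈ ofColour (earlier v) col (col v)
    earlier-of-own-colour i iv = ∈-tabulate⁺ (cong₂ _∧_
      (earlier-if-adjacent iv (≤-maxIndex (pos ∘ vertex) i))
      (dec-true (col (vertex i) ≟ col v) (trans (coloured i) (sym (coloured j)))))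

    two-earlier : 1 < ∣ ofColour (earlier v) col (col v) ∣
    two-earlier =
      let a , b , a≢b , av , bv = cycle-neighbours cycle j in
      x∈p∧y∈p∧x≢y⇒2≤∣p∣ (earlier-of-own-colour a av) (earlier-of-own-colour b bv) (a≢b ∘ distinct)

∣∁p∣+∣p∣≡n : ∀ (p : Subset n) → ∣ ∁ p ∣ + ∣ p ∣ ≡ n
∣∁p∣+∣p∣≡n p = trans (cong (_+ ∣ p ∣) (∣∁p∣≡n∸∣p∣ p)) (m∸n+n≡m (∣p∣≤n p))

complement-bound : ∀ {s r n} t → s + r ≡ n → n ≤ suc t * r → suc t * s ≤ t * n
complement-bound {s} {r} t refl n≤ = begin
  s + t * s      ≤⟨ +-monoˡ-≤ (t * s) s≤tr ⟩
  t * r + t * s  ≡⟨ *-distribˡ-+ t r s ⟨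
  t * (r + s)    ≡⟨ cong (t *_) (+-comm r s) ⟩
  t * (s + r)    ∎
  where
  open ≤-Reasoning
  s≤tr : s ≤ t * r
  s≤tr = +-cancelʳ-≤ r s (t * r) (≤-trans n≤ (≤-reflexive (+-comm r (t * r))))

FVSNumberAtMostFrac-scale : ∀ {G : Graph n} {p q} c →
  FVSNumberAtMostFrac G p q → FVSNumberAtMostFrac G (p * c) (q * c)
FVSNumberAtMostFrac-scale {n} {p = p} {q} c (S , isFVS , q∣S∣≤pn) =
  S , isFVS , subst₂ _≤_ (xy∙z≈xz∙y q ∣ S ∣ c) (xy∙z≈xz∙y p n c) (*-monoˡ-≤ c q∣S∣≤pn)

FVSNumberAtMostFrac-from-ordering : ∀ (G : Graph n) {k} t → HasDegOrdering G k → k < suc t * 2 →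
  FVSNumberAtMostFrac G t (suc t)
FVSNumberAtMostFrac-from-ordering G t (σ , back≤k) k<2t+2 =
  let col , good        = ∃-colouring G σ {m = t} (λ v → ≤-<-trans (back≤k v) k<2t+2)
      c , n≤[t+1]∣class∣ = ∃-≥-average (∣_∣ ∘ colourClass col)
  in ∁ (colourClass col c) , ∁-colourClass-isFVS G σ col good c ,
     complement-bound t (∣∁p∣+∣p∣≡n (colourClass col c))
                        (subst (_≤ suc t * ∣ colourClass col c ∣) (∑-∣colourClass∣ col) n≤[t+1]∣class∣)

proposition4p2 : ∀ {n} (G : Graph n) (k : ℕ) → Degeneracy G k →
    (k % 2 ≡ 1 → FVSNumberAtMostFrac G (k ∸ 1) (k + 1))
    × (k % 2 ≡ 0 → FVSNumberAtMostFrac G k (k + 2))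
proposition4p2 G k (ordering , _) = odd , even
  where
  t : ℕ
  t = k / 2

  k≡r+2t : ∀ {r} → k % 2 ≡ r → k ≡ r + t * 2
  k≡r+2t k%2≡r = trans (m≡m%n+[m/n]*n k 2) (cong (_+ t * 2) k%2≡r)

  bound : k < suc t * 2 → FVSNumberAtMostFrac G (t * 2) (suc t * 2)
  bound k<2t+2 =
    FVSNumberAtMostFrac-scale {p = t} {suc t} 2 (FVSNumberAtMostFrac-from-ordering G t ordering k<2t+2)

  odd : k % 2 ≡ 1 → FVSNumberAtMostFrac G (k ∸ 1) (k + 1)
  odd k%2≡1 = subst₂ (FVSNumberAtMostFrac G)
    (cong (_∸ 1) (sym k≡1+2t)) (trans (cong suc (sym k≡1+2t)) (+-comm 1 k))
    (bound (≤-reflexive (cong suc k≡1+2t)))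
    where
    k≡1+2t : k ≡ 1 + t * 2
    k≡1+2t = k≡r+2t k%2≡1

  even : k % 2 ≡ 0 → FVSNumberAtMostFrac G k (k + 2)
  even k%2≡0 = subst₂ (FVSNumberAtMostFrac G)
    (sym k≡2t) (trans (cong (2 +_) (sym k≡2t)) (+-comm 2 k))
    (bound (≤-trans (s≤s (≤-reflexive k≡2t)) (n≤1+n _)))
    where
    k≡2t : k ≡ t * 2
    k≡2t = k≡r+2t k%2≡0
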